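{- Let $w,n$ be positive integers and let $R$ be a semistandard Young tableau of rectangular shape with $w$ columns and $n$ rows whose content consists of $w-1$ copies of each of $1,\ldots,n$ and one copy of each of $n+1,\ldots,2n$. Let $Q$ be obtained from the cells of $R$ containing entries in $\{n+1,\ldots,2n\}$ by rotating them by $180^\circ$ and replacing each entry $x$ by $2n-x+1$; let $\lambda$ be its shape. Let $P = \overline{R-Q}^{w,n}$. Then $P$ is a standard Young tableau and has the same shape $\lambda$ as $Q$.
   Context: Tableaux are semistandard (rows weakly, columns strictly increasing); standard means each entry appears once and rows are also strictly increasing. Columns are indexed from left to right. For a tableau $R$ of the $w\times n$ rectangular shape ($w$ columns, $n$ rows) and a Young diagram $\lambda$ with at most $w$ columns and column lengths $\lambda_1\ge\lambda_2\ge\cdots$ (at most $n$), $R-Q$ (with $Q$ of shape $\lambda$) is the tableau whose $i$-th column consists of the $n-\lambda_{w-i+1}$ smallest entries of the $i$-th column of $R$, i.e. $R$ with a $180^\circ$-rotated copy of $\lambda$ removed from its bottom-right corner. For a tableau $A$ with columns $A_1,\ldots,A_w$ (possibly empty) and entries in $[n]$, the tableau complement $\overline{A}^{w,n}$ has $i$-th column equal to $[n]\setminus A_{w-i+1}$ in increasing order, for $1\le i\le w$. -}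

module Defs where

open import Data.Nat using (ℕ; zero; suc; _+_; _*_; _∸_; _≤_; _<_; _<?_)
open import Data.Nat.Properties using (_≟_)
open import Data.List using (List; []; _∷_; length; map; concat; reverse; replicate; filter; take; zipWith; upTo; _++_; all)
open import Data.List.Membership.DecPropositional _≟_ using (_∉?_)
open import Data.List.Relation.Unary.All using (All)
open import Data.List.Relation.Unary.Linked using (Linked)
open import Data.List.Relation.Binary.Permutation.Propositional using (_↭_)
open import Data.Maybe using (Maybe; just; nothing; _>>=_)
open import Relation.Binary.PropositionalEquality using (_≡_)
open import Data.Product using (_×_)

-- A tableau is a list of columns (left to right); each column is listed
-- top to bottom.  Cell (i , j) = column i, row j (both 0-indexed).
Tab : Set
Tab = List (List ℕ)

_‼_ : {A : Set} → List A → ℕ → Maybe A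
[] ‼ _ = nothing
(x ∷ xs) ‼ zero = just x
(x ∷ xs) ‼ suc k = xs ‼ k

at : Tab → ℕ → ℕ → Maybe ℕ
at T i j = (T ‼ i) >>= (_‼ j)

shape : Tab → List ℕ
shape T = map length T

IsYoung : List ℕ → Set
IsYoung λs = Linked (λ a b → b ≤ a) λs

RowsWeak : Tab → Set
RowsWeak T = ∀ {i i' j a b} → i < i' → at T i j ≡ just a → at T i' j ≡ just b → a ≤ b

RowsStrict : Tab → Set
RowsStrict T = ∀ {i i' j a b} → i < i' → at T i j ≡ just a → at T i' j ≡ just b → a < b

ColsStrict : Tab → Set
ColsStrict T = ∀ {i j j' a b} → j < j' → at T i j ≡ just a → at T i j' ≡ just b → a < b

Semistandard : Tab → Set
Semistandard T = IsYoung (shape T) × RowsWeak T × ColsStrict T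

oneTo : ℕ → List ℕ
oneTo k = map suc (upTo k)

Standard : Tab → Set
Standard T = Semistandard T × RowsStrict T × (concat T ↭ oneTo (length (concat T)))

Rectangular : ℕ → ℕ → Tab → Set
Rectangular w n R = (length R ≡ w) × All (λ c → length c ≡ n) R

HasContent : ℕ → ℕ → Tab → Set
HasContent w n R = concat R ↭ (concat (replicate (w ∸ 1) (oneTo n)) ++ map (n +_) (oneTo n))

-- Q: the cells of R with entries in {n+1..2n} rotated by 180 degrees
-- (column i of R becomes column w-1-i, and a column is read bottom to top),
-- each entry x replaced by 2n - x + 1.  (Entries > n in a column of R are
-- the bottom cells of that column by column-strictness; filtering keeps them.)
Qof : ℕ → Tab → Tab
Qof n R = map (λ col → map (λ x → (2 * n + 1) ∸ x) (reverse (filter (n <?_) col))) (reverse R)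

pad : ℕ → List ℕ → List ℕ
pad w λs = λs ++ replicate (w ∸ length λs) 0

-- R - Q for R of shape w × n and Q of shape λ: the i-th column keeps the
-- n - λ_{w-i+1} smallest (= top) entries of the i-th column of R
minus : ℕ → ℕ → Tab → List ℕ → Tab
minus w n R λs = zipWith (λ col l → take (n ∸ l) col) R (reverse (pad w λs))

-- complement: i-th column is [n] \ A_{w-i+1} in increasing order
-- (A padded with empty columns to w columns)
padT : ℕ → Tab → Tab
padT w A = A ++ replicate (w ∸ length A) []

complementT : ℕ → ℕ → Tab → Tab
complementT w n A = map (λ c → filter (_∉? c) (oneTo n)) (reverse (padT w A))

module Submission where

-- Write [n] = 1,…,n.  For a column c of R (strictly increasing, of length n,
-- positive entries) let low c be its entries ≤ n (an initial segment of c),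
-- overflow c the number of its entries > n, and gaps c = [n] ∖ low c.  Then
--   * R - Q keeps exactly the low part of every column, because Q has column
--     lengths overflow c (in reverse order); hence P = map gaps (reverse R),
--     and |gaps c| = overflow c gives shape P = shape Q;
--   * counting content, each x ∈ [n] occurs in w-1 of the w columns of R,
--     so it is a gap of exactly one column: the columns of P are disjoint
--     and together contain [n] exactly once;
--   * if c lies left of d in R then c ≤ d entrywise, so at most as many
--     entries of d as of c are ≤ b; complementing in [1..b], at least as many
--     gaps of d as of c are ≤ b.  Comparing ranks, the j-th gap of d is ≤ the
--     j-th gap of c, and the two differ since no x is a gap of two columns.
--     This makes the rows of P strictly increasing and its shape a partition.

open import Defs
open import Data.Nat using (ℕ; zero; suc; _+_; _*_; _∸_; _≤_; _<_; _<?_; _≤?_; z≤n; s≤s; s≤s⁻¹)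
open import Data.Nat.Properties
open import Data.List using (List; []; _∷_; length; map; concat; reverse; replicate; filter; take; zipWith; upTo; _++_)
open import Data.List.Properties
  using (length-map; length-++; length-reverse; reverse-map; reverse-involutive; length-upTo;
         filter-accept; filter-reject; filter-all; filter-some; filter-none; filter-++; unfold-reverse; ++-identityʳ;
         map-∘; map-cong-local)
open import Data.List.Membership.Propositional using (_∈_; _∉_; lose)
open import Data.List.Membership.Propositional.Properties
  using (∈-filter⁺; ∈-filter⁻; ∈-++⁺ˡ; ∈-++⁺ʳ; ∈-++⁻; ∈-map⁺; ∈-map⁻; ∈-upTo⁺; ∈-upTo⁻;
         ∈-concat⁺′; ∈-concat⁻′)
open import Data.List.Membership.Propositional.Properties.WithK using (unique∧set⇒bag)
open import Data.List.Membership.DecPropositional _≟_ using (_∈?_; _∉?_)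
open import Data.List.Relation.Unary.All as All using (All; []; _∷_)
import Data.List.Relation.Unary.All.Properties as AllP
import Data.List.Relation.Unary.Any.Properties as AnyP
open import Data.List.Relation.Unary.Any using (here; there)
open import Data.List.Relation.Unary.AllPairs as AllPairs using (AllPairs; []; _∷_)
import Data.List.Relation.Unary.AllPairs.Properties as AllPairsP
open import Data.List.Relation.Unary.Linked.Properties using (AllPairs⇒Linked)
open import Data.List.Relation.Unary.Unique.Propositional using (Unique)
import Data.List.Relation.Unary.Unique.Propositional.Properties as UniqueP
open import Data.List.Relation.Binary.Pointwise using (Pointwise; []; _∷_)
open import Data.List.Relation.Binary.Subset.Propositional using (_⊆_)
open import Data.List.Relation.Binary.Disjoint.Propositional using (Disjoint)
open import Data.List.Relation.Binary.Permutation.Propositional using (_↭_; ↭-sym)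
open import Data.List.Relation.Binary.Permutation.Propositional.Properties using (↭-length; filter-↭; All-resp-↭)
open import Data.List.Relation.Binary.BagAndSetEquality using (∼bag⇒↭)
open import Data.Maybe using (Maybe; just; _>>=_)
open import Data.Product using (∃; _×_; _,_; proj₁; proj₂)
open import Data.Empty using (⊥; ⊥-elim)
open import Data.Unit using (tt)
open import Data.Sum using (inj₁; inj₂)
open import Function using (id; flip; _∘_)
open import Function.Bundles using (mk⇔)
open import Level using (0ℓ)
open import Relation.Binary.PropositionalEquality
open import Relation.Nullary using (¬_; yes; no)
open import Relation.Unary using (Pred; Decidable; U)
open import Relation.Unary.Properties using (U?)

Sorted : List ℕ → Set
Sorted = AllPairs _<_

∈⇒‼ : ∀ {A : Set} {x : A} {xs} → x ∈ xs → ∃ λ k → xs ‼ k ≡ just x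
∈⇒‼ (here refl) = 0 , refl
∈⇒‼ (there x∈xs) with k , e ← ∈⇒‼ x∈xs = suc k , e

‼⇒∈ : ∀ {A : Set} {x : A} xs k → xs ‼ k ≡ just x → x ∈ xs
‼⇒∈ (y ∷ xs) zero    refl = here refl
‼⇒∈ (y ∷ xs) (suc k) e    = there (‼⇒∈ xs k e)

IndexedPairs : {A : Set} → (A → A → Set) → List A → Set
IndexedPairs R xs = ∀ {i i' a b} → i < i' → xs ‼ i ≡ just a → xs ‼ i' ≡ just b → R a b

AllPairs⇒Indexed : ∀ {A : Set} {R : A → A → Set} {xs} → AllPairs R xs → IndexedPairs R xs
AllPairs⇒Indexed {xs = x ∷ xs} (Rx ∷ _)  {zero}  {suc i'} _         refl e  = All.lookup Rx (‼⇒∈ xs i' e)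
AllPairs⇒Indexed {xs = x ∷ xs} (_ ∷ Rxs) {suc i} {suc i'} (s≤s i<i') e e' = AllPairs⇒Indexed Rxs i<i' e e'

Indexed⇒AllPairs : ∀ {A : Set} {R : A → A → Set} {xs} → IndexedPairs R xs → AllPairs R xs
Indexed⇒AllPairs {xs = []}     _ = []
Indexed⇒AllPairs {xs = x ∷ xs} h =
  All.tabulate (λ y∈xs → h {0} (s≤s z≤n) refl (proj₂ (∈⇒‼ y∈xs)))
  ∷ Indexed⇒AllPairs (λ lt e e' → h (s≤s lt) e e')

All-reverse : ∀ {A : Set} {P : A → Set} {xs} → All P xs → All P (reverse xs)
All-reverse Pxs = All.tabulate (λ y∈ → All.lookup Pxs (AnyP.reverse⁻ y∈))

AllPairs-reverse : ∀ {A : Set} {R : A → A → Set} {xs} → AllPairs R xs → AllPairs (flip R) (reverse xs)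
AllPairs-reverse {xs = []}     [] = []
AllPairs-reverse {xs = x ∷ xs} (Rx ∷ Rxs) rewrite unfold-reverse x xs =
  AllPairsP.++⁺ (AllPairs-reverse Rxs) ([] ∷ []) (All.map (_∷ []) (All-reverse Rx))

AllPairs-All : ∀ {A : Set} {P : A → Set} {R : A → A → Set} {xs} →
  All P xs → AllPairs R xs → AllPairs (λ a b → P a × P b × R a b) xs
AllPairs-All []         []         = []
AllPairs-All (px ∷ pxs) (Rx ∷ Rxs) = All.zipWith (λ (py , r) → px , py , r) (pxs , Rx) ∷ AllPairs-All pxs Rxs

pad-full : ∀ {A : Set} (a : A) w xs → length xs ≡ w → xs ++ replicate (w ∸ length xs) a ≡ xs
pad-full a w xs refl rewrite n∸n≡0 (length xs) = ++-identityʳ xs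

RowWeak RowStrict : List ℕ → List ℕ → Set
RowWeak   c d = ∀ {j a b} → c ‼ j ≡ just a → d ‼ j ≡ just b → a ≤ b
RowStrict c d = ∀ {j a b} → c ‼ j ≡ just a → d ‼ j ≡ just b → a < b

at-column : ∀ {m : Maybe (List ℕ)} {c} j → m ≡ just c → (m >>= (_‼ j)) ≡ c ‼ j
at-column j refl = refl

at-inv : ∀ (m : Maybe (List ℕ)) j {a} → (m >>= (_‼ j)) ≡ just a → ∃ λ c → m ≡ just c × c ‼ j ≡ just a
at-inv (just c) j e = c , refl , e

rowsWeak⇒AllPairs : ∀ {T} → RowsWeak T → AllPairs RowWeak T
rowsWeak⇒AllPairs rw = Indexed⇒AllPairs λ {_} {_} lt ec ed {j} ea eb →
  rw lt (trans (at-column j ec) ea) (trans (at-column j ed) eb)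

AllPairs⇒rowsStrict : ∀ {T} → AllPairs RowStrict T → RowsStrict T
AllPairs⇒rowsStrict {T} rs {i} {i'} {j} lt ea eb
  with c , ec , ea' ← at-inv (T ‼ i) j ea | d , ed , eb' ← at-inv (T ‼ i') j eb =
  AllPairs⇒Indexed rs lt ec ed ea' eb'

colsStrict⇒sorted : ∀ {T} → ColsStrict T → All Sorted T
colsStrict⇒sorted cs = All.tabulate λ c∈T → let (_ , ec) = ∈⇒‼ c∈T in
  Indexed⇒AllPairs λ {j} {j'} lt ea eb → cs lt (trans (at-column j ec) ea) (trans (at-column j' ec) eb)

sorted⇒colsStrict : ∀ {T} → All Sorted T → ColsStrict T
sorted⇒colsStrict {T} sorted {i} {j} {j'} lt ea eb
  with c , ec , ea' ← at-inv (T ‼ i) j ea | d , ed , eb' ← at-inv (T ‼ i) j' eb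
  with refl ← trans (sym ec) ed =
  AllPairs⇒Indexed (All.lookup sorted (‼⇒∈ T i ec)) lt ea' eb'

length-filter-split : ∀ {A : Set} {P Q : Pred A 0ℓ} (P? : Decidable P) (Q? : Decidable Q) →
  (∀ {x} → P x → ¬ Q x) → (∀ {x} → ¬ P x → Q x) →
  ∀ xs → length (filter P? xs) + length (filter Q? xs) ≡ length xs
length-filter-split P? Q? P⇒¬Q ¬P⇒Q [] = refl
length-filter-split P? Q? P⇒¬Q ¬P⇒Q (x ∷ xs) with P? x
... | yes p rewrite filter-reject Q? {x} {xs} (P⇒¬Q p) =
  cong suc (length-filter-split P? Q? P⇒¬Q ¬P⇒Q xs)
... | no ¬p rewrite filter-accept Q? {x} {xs} (¬P⇒Q ¬p) =
  trans (+-suc _ _) (cong suc (length-filter-split P? Q? P⇒¬Q ¬P⇒Q xs))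

filter-absorb : ∀ {A : Set} {P Q : Pred A 0ℓ} (P? : Decidable P) (Q? : Decidable Q) →
  (∀ {x} → P x → Q x) → ∀ xs → filter P? (filter Q? xs) ≡ filter P? xs
filter-absorb P? Q? P⇒Q [] = refl
filter-absorb P? Q? P⇒Q (x ∷ xs) with Q? x | P? x
... | yes _ | yes p rewrite filter-accept P? {x} {filter Q? xs} p = cong (x ∷_) (filter-absorb P? Q? P⇒Q xs)
... | yes _ | no ¬p rewrite filter-reject P? {x} {filter Q? xs} ¬p = filter-absorb P? Q? P⇒Q xs
... | no ¬q | yes p = ⊥-elim (¬q (P⇒Q p))
... | no _  | no _  = filter-absorb P? Q? P⇒Q xs

at-most-one : ∀ {A : Set} {P : Pred A 0ℓ} (P? : Decidable P) xs →
  length (filter P? xs) ≤ 1 → AllPairs (λ a b → P a → ¬ P b) xs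
at-most-one P? [] _ = []
at-most-one P? (y ∷ ys) le with P? y
... | no ¬p = All.universal (λ _ p → ⊥-elim (¬p p)) ys ∷ at-most-one P? ys le
... | yes _ = All.tabulate (λ z∈ys _ pz → <⇒≱ (filter-some P? (lose z∈ys pz)) (s≤s⁻¹ le))
              ∷ at-most-one P? ys (≤-trans (s≤s⁻¹ le) z≤n)

some-witness : ∀ {A : Set} {P : Pred A 0ℓ} (P? : Decidable P) xs →
  1 ≤ length (filter P? xs) → ∃ λ a → a ∈ xs × P a
some-witness P? (y ∷ ys) le with P? y
... | yes p = y , here refl , p
... | no _ with a , a∈ys , pa ← some-witness P? ys le = a , there a∈ys , pa

multiplicity : ℕ → List ℕ → ℕ
multiplicity x xs = length (filter (x ≟_) xs)

multiplicity-++ : ∀ x xs ys → multiplicity x (xs ++ ys) ≡ multiplicity x xs + multiplicity x ys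
multiplicity-++ x xs ys = trans (cong length (filter-++ (x ≟_) xs ys)) (length-++ (filter (x ≟_) xs))

multiplicity-∉ : ∀ {x xs} → x ∉ xs → multiplicity x xs ≡ 0
multiplicity-∉ {x} {xs} x∉xs =
  cong length (filter-none (x ≟_) (All.tabulate λ {y} y∈xs x≡y → x∉xs (subst (_∈ xs) (sym x≡y) y∈xs)))

multiplicity-unique : ∀ {x xs} → Unique xs → x ∈ xs → multiplicity x xs ≡ 1
multiplicity-unique {x} {_ ∷ ys} (x∉ys ∷ _) (here refl) rewrite filter-accept (x ≟_) {x} {ys} refl =
  cong suc (multiplicity-∉ λ x∈ys → All.lookup x∉ys x∈ys refl)
multiplicity-unique {x} {y ∷ ys} (y∉ys ∷ u) (there x∈ys)
  rewrite filter-reject (x ≟_) {y} {ys} (λ x≡y → All.lookup y∉ys x∈ys (sym x≡y)) =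
  multiplicity-unique u x∈ys

multiplicity-concat : ∀ x xss → All Unique xss → multiplicity x (concat xss) ≡ length (filter (x ∈?_) xss)
multiplicity-concat x [] [] = refl
multiplicity-concat x (xs ∷ xss) (u ∷ us) with x ∈? xs
... | yes x∈ = trans (multiplicity-++ x xs (concat xss)) (cong₂ _+_ (multiplicity-unique u x∈) (multiplicity-concat x xss us))
... | no  x∉ = trans (multiplicity-++ x xs (concat xss)) (cong₂ _+_ (multiplicity-∉ x∉) (multiplicity-concat x xss us))

multiplicity-replicate : ∀ {x xs} → Unique xs → x ∈ xs → ∀ k → multiplicity x (concat (replicate k xs)) ≡ k
multiplicity-replicate u x∈ zero = refl
multiplicity-replicate {x} {xs} u x∈ (suc k) =
  trans (multiplicity-++ x xs _) (cong₂ _+_ (multiplicity-unique u x∈) (multiplicity-replicate u x∈ k))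

rank : ℕ → List ℕ → ℕ
rank b xs = length (filter (_≤? b) xs)

rank-of-entry : ∀ {xs j b} → Sorted xs → xs ‼ j ≡ just b → suc j ≤ rank b xs
rank-of-entry {x ∷ xs} {zero} {b} _ refl rewrite filter-accept (_≤? b) {x} {xs} ≤-refl = s≤s z≤n
rank-of-entry {x ∷ xs} {suc j} {b} (x< ∷ sorted) e
  rewrite filter-accept (_≤? b) {x} {xs} (<⇒≤ (All.lookup x< (‼⇒∈ xs j e))) = s≤s (rank-of-entry sorted e)

entry-from-rank : ∀ {xs j a b} → Sorted xs → xs ‼ j ≡ just a → suc j ≤ rank b xs → a ≤ b
entry-from-rank {x ∷ xs} {j} {a} {b} (x< ∷ sorted) e le with x ≤? b
... | no x≰b rewrite filter-reject (_≤? b) {x} {xs} x≰b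
  | filter-none (_≤? b) (All.map (λ x<y y≤b → x≰b (<⇒≤ (<-≤-trans x<y y≤b))) x<) with () ← le
entry-from-rank {x ∷ xs} {zero}  (_ ∷ _) refl le | yes x≤b = x≤b
entry-from-rank {x ∷ xs} {suc j} {b = b} (_ ∷ sorted) e le | yes x≤b
  rewrite filter-accept (_≤? b) {x} {xs} x≤b = entry-from-rank sorted e (s≤s⁻¹ le)

sorted-split : ∀ t {c} → Sorted c → c ≡ filter (_≤? t) c ++ filter (t <?_) c
sorted-split t {[]} [] = refl
sorted-split t {x ∷ c} (x< ∷ sorted) with x ≤? t
... | yes x≤t rewrite filter-accept (_≤? t) {x} {c} x≤t | filter-reject (t <?_) {x} {c} (≤⇒≯ x≤t) =
  cong (x ∷_) (sorted-split t sorted)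
... | no x≰t rewrite filter-reject (_≤? t) {x} {c} x≰t | filter-accept (t <?_) {x} {c} (≰⇒> x≰t)
  | filter-none (_≤? t) (All.map (λ x<y y≤t → x≰t (<⇒≤ (<-≤-trans x<y y≤t))) x<)
  | filter-all (t <?_) (All.map (<-trans (≰⇒> x≰t)) x<) = refl

take-length-++ : ∀ {A : Set} (xs ys : List A) → take (length xs) (xs ++ ys) ≡ xs
take-length-++ []       ys = refl
take-length-++ (x ∷ xs) ys = cong (x ∷_) (take-length-++ xs ys)

‼⇒Pointwise : ∀ {R : ℕ → ℕ → Set} {xs ys} → length xs ≡ length ys →
  (∀ {j a b} → xs ‼ j ≡ just a → ys ‼ j ≡ just b → R a b) → Pointwise R xs ys
‼⇒Pointwise {xs = []}     {[]}     _ _ = []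
‼⇒Pointwise {xs = x ∷ xs} {y ∷ ys} e R‼ =
  R‼ {0} refl refl ∷ ‼⇒Pointwise (suc-injective e) (λ {j} → R‼ {suc j})

Pointwise-count : ∀ {R : ℕ → ℕ → Set} {P Q : Pred ℕ 0ℓ} (P? : Decidable P) (Q? : Decidable Q) →
  (∀ {x y} → R x y → P x → Q y) → ∀ {xs ys} → Pointwise R xs ys → length (filter P? xs) ≤ length (filter Q? ys)
Pointwise-count P? Q? transfer [] = z≤n
Pointwise-count P? Q? transfer {x ∷ xs} {y ∷ ys} (r ∷ rs) with P? x
... | yes px rewrite filter-accept Q? {y} {ys} (transfer r px) = s≤s (Pointwise-count P? Q? transfer rs)
... | no _ with Q? y
...   | yes _ = m≤n⇒m≤1+n (Pointwise-count P? Q? transfer rs)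
...   | no _  = Pointwise-count P? Q? transfer rs

_∖_ : List ℕ → List ℕ → List ℕ
L ∖ A = filter (_∉? A) L

↭-from-sets : ∀ {xs ys : List ℕ} → Unique xs → Unique ys → xs ⊆ ys → ys ⊆ xs → xs ↭ ys
↭-from-sets u v xs⊆ys ys⊆xs = ∼bag⇒↭ (unique∧set⇒bag u v (mk⇔ xs⊆ys ys⊆xs))

complement-count : ∀ {Q : Pred ℕ 0ℓ} (Q? : Decidable Q) {L A : List ℕ} → Unique L → Unique A → A ⊆ L →
  length (filter Q? (L ∖ A)) + length (filter Q? A) ≡ length (filter Q? L)
complement-count Q? {L} {A} uL uA A⊆L = trans (sym (length-++ (filter Q? (L ∖ A)))) (↭-length split↭)
  where
  disjoint : ∀ {v} → ¬ (v ∈ filter Q? (L ∖ A) × v ∈ filter Q? A)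
  disjoint (v∈₁ , v∈₂) =
    proj₂ (∈-filter⁻ (_∉? A) {xs = L} (proj₁ (∈-filter⁻ Q? {xs = L ∖ A} v∈₁)))
          (proj₁ (∈-filter⁻ Q? {xs = A} v∈₂))
  into : filter Q? (L ∖ A) ++ filter Q? A ⊆ filter Q? L
  into v∈ with ∈-++⁻ (filter Q? (L ∖ A)) v∈
  ... | inj₁ v∈₁ = let (v∈L∖A , qv) = ∈-filter⁻ Q? {xs = L ∖ A} v∈₁ in
                   ∈-filter⁺ Q? (proj₁ (∈-filter⁻ (_∉? A) {xs = L} v∈L∖A)) qv
  ... | inj₂ v∈₂ = let (v∈A , qv) = ∈-filter⁻ Q? {xs = A} v∈₂ in ∈-filter⁺ Q? (A⊆L v∈A) qv
  onto : filter Q? L ⊆ filter Q? (L ∖ A) ++ filter Q? A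
  onto {v} v∈ with ∈-filter⁻ Q? {xs = L} v∈ | v ∈? A
  ... | v∈L , qv | yes v∈A = ∈-++⁺ʳ (filter Q? (L ∖ A)) (∈-filter⁺ Q? v∈A qv)
  ... | v∈L , qv | no  v∉A = ∈-++⁺ˡ (∈-filter⁺ Q? (∈-filter⁺ (_∉? A) v∈L v∉A) qv)
  split↭ : filter Q? (L ∖ A) ++ filter Q? A ↭ filter Q? L
  split↭ = ↭-from-sets
    (UniqueP.++⁺ (UniqueP.filter⁺ Q? (UniqueP.filter⁺ (_∉? A) uL)) (UniqueP.filter⁺ Q? uA) disjoint)
    (UniqueP.filter⁺ Q? uL) into onto

complement-length : ∀ {L A : List ℕ} → Unique L → Unique A → A ⊆ L → length (L ∖ A) + length A ≡ length L
complement-length {L} {A} uL uA A⊆L =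
  subst₂ (λ u v → length u + length v ≡ length L) (unfiltered (L ∖ A)) (unfiltered A)
    (trans (complement-count U? uL uA A⊆L) (cong length (unfiltered L)))
  where
  unfiltered : ∀ xs → filter U? xs ≡ xs
  unfiltered xs = filter-all U? (All.universal (λ _ → tt) xs)

module Columns (n : ℕ) where

  range : List ℕ
  range = oneTo n

  low : List ℕ → List ℕ
  low c = filter (_≤? n) c

  overflow : List ℕ → ℕ
  overflow c = length (filter (n <?_) c)

  gaps : List ℕ → List ℕ
  gaps c = range ∖ low c

  IsColumn : List ℕ → Set
  IsColumn c = Sorted c × length c ≡ n × All (1 ≤_) c

  NoCommonGap : List ℕ → List ℕ → Set
  NoCommonGap c d = ∀ {x} → x ∈ range → x ∉ c → x ∉ d → ⊥

  range-sorted : Sorted range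
  range-sorted = AllPairsP.map⁺ (AllPairsP.applyUpTo⁺₁ id n (λ i<j _ → s≤s i<j))

  range-unique : Unique range
  range-unique = AllPairs.map <⇒≢ range-sorted

  range-length : length range ≡ n
  range-length = trans (length-map suc (upTo n)) (length-upTo n)

  ∈-range⁺ : ∀ {x} → 1 ≤ x → x ≤ n → x ∈ range
  ∈-range⁺ {suc y} _ y<n = ∈-map⁺ suc (∈-upTo⁺ y<n)

  ∈-range⁻ : ∀ {x} → x ∈ range → 1 ≤ x × x ≤ n
  ∈-range⁻ x∈ with y , y∈ , refl ← ∈-map⁻ suc x∈ = s≤s z≤n , ∈-upTo⁻ y∈

  low-unique : ∀ {c} → Sorted c → Unique (low c)
  low-unique sorted = UniqueP.filter⁺ (_≤? n) (AllPairs.map <⇒≢ sorted)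

  low-⊆-range : ∀ {c} → All (1 ≤_) c → low c ⊆ range
  low-⊆-range {c} pos x∈ with x∈c , x≤n ← ∈-filter⁻ (_≤? n) {xs = c} x∈ =
    ∈-range⁺ (All.lookup pos x∈c) x≤n

  gaps-sorted : ∀ c → Sorted (gaps c)
  gaps-sorted c = AllPairsP.filter⁺ (_∉? low c) range-sorted

  ∈-gaps : ∀ {c x} → x ∈ gaps c → x ∈ range × x ∉ c
  ∈-gaps {c} x∈ with x∈range , x∉low ← ∈-filter⁻ (_∉? low c) {xs = range} x∈ =
    x∈range , λ x∈c → x∉low (∈-filter⁺ (_≤? n) x∈c (proj₂ (∈-range⁻ x∈range)))

  gaps-disjoint : ∀ {c d} → NoCommonGap c d → Disjoint (gaps d) (gaps c)
  gaps-disjoint {c} {d} no-common (x∈d , x∈c) =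
    no-common (proj₁ (∈-gaps {c} x∈c)) (proj₂ (∈-gaps {c} x∈c)) (proj₂ (∈-gaps {d} x∈d))

  low+overflow : ∀ c → length (low c) + overflow c ≡ length c
  low+overflow = length-filter-split (_≤? n) (n <?_) ≤⇒≯ ≰⇒>

  gaps-length : ∀ {c} → IsColumn c → length (gaps c) ≡ overflow c
  gaps-length {c} (sorted , len , pos) = +-cancelʳ-≡ (length (low c)) _ _ (begin
    length (gaps c) + length (low c)  ≡⟨ complement-length range-unique (low-unique sorted) (low-⊆-range pos) ⟩
    length range                      ≡⟨ range-length ⟩
    n                                 ≡⟨ sym (trans (low+overflow c) len) ⟩
    length (low c) + overflow c       ≡⟨ +-comm (length (low c)) (overflow c) ⟩
    overflow c + length (low c)       ∎)
    where open ≡-Reasoning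

  take-low : ∀ {c} → IsColumn c → take (n ∸ overflow c) c ≡ low c
  take-low {c} (sorted , len , _) = begin
    take (n ∸ overflow c) c                                ≡⟨ cong (λ k → take k c) kept ⟩
    take (length (low c)) c                                ≡⟨ cong (take (length (low c))) (sorted-split n sorted) ⟩
    take (length (low c)) (low c ++ filter (n <?_) c)      ≡⟨ take-length-++ (low c) _ ⟩
    low c                                                  ∎
    where
    open ≡-Reasoning
    kept : n ∸ overflow c ≡ length (low c)
    kept = trans (cong (_∸ overflow c) (sym (trans (low+overflow c) len))) (m+n∸n≡m (length (low c)) (overflow c))

  overflow-mono : ∀ {c d} → IsColumn c → IsColumn d → RowWeak c d → overflow c ≤ overflow d
  overflow-mono {c} {d} (_ , lc , _) (_ , ld , _) c≤d =
    Pointwise-count (n <?_) (n <?_) (λ a≤b n<a → <-≤-trans n<a a≤b)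
      (‼⇒Pointwise {xs = c} {d} (trans lc (sym ld)) c≤d)

  -- If c ≤ d entrywise then, below any b ≤ n, d has at least as many gaps as c:
  -- the gaps and the low entries below b together make up [1..b].
  gaps-rank-mono : ∀ {c d b} → IsColumn c → IsColumn d → RowWeak c d → b ≤ n → rank b (gaps c) ≤ rank b (gaps d)
  gaps-rank-mono {c} {d} {b} (sc , lc , pc) (sd , ld , pd) c≤d b≤n = +-cancelʳ-≤ (rank b (low c)) _ _ (begin
    rank b (gaps c) + rank b (low c)  ≡⟨ complement-count (_≤? b) range-unique (low-unique sc) (low-⊆-range pc) ⟩
    rank b range                      ≡⟨ complement-count (_≤? b) range-unique (low-unique sd) (low-⊆-range pd) ⟨
    rank b (gaps d) + rank b (low d)  ≤⟨ +-monoʳ-≤ (rank b (gaps d)) low-rank ⟩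
    rank b (gaps d) + rank b (low c)  ∎)
    where
    open ≤-Reasoning
    low-rank : rank b (low d) ≤ rank b (low c)
    low-rank = subst₂ _≤_ (sym (below-low d)) (sym (below-low c))
      (Pointwise-count (_≤? b) (_≤? b) (λ y≤x x≤b → ≤-trans y≤x x≤b)
        (‼⇒Pointwise {xs = d} {c} (trans ld (sym lc)) (λ ed ec → c≤d ec ed)))
      where
      below-low : ∀ e → rank b (low e) ≡ rank b e
      below-low e = cong length (filter-absorb (_≤? b) (_≤? n) (λ x≤b → ≤-trans x≤b b≤n) e)

  gaps-row-strict : ∀ {c d} → IsColumn c → IsColumn d → RowWeak c d → NoCommonGap c d → RowStrict (gaps d) (gaps c)
  gaps-row-strict {c} {d} col-c col-d c≤d no-common {j} {a} {b} ea eb = ≤∧≢⇒< a≤b a≢b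
    where
    b-gap : b ∈ range × b ∉ c
    b-gap = ∈-gaps {c} (‼⇒∈ (gaps c) j eb)
    a≤b : a ≤ b
    a≤b = entry-from-rank (gaps-sorted d) ea (≤-trans (rank-of-entry (gaps-sorted c) eb)
            (gaps-rank-mono col-c col-d c≤d (proj₂ (∈-range⁻ (proj₁ b-gap)))))
    a≢b : a ≢ b
    a≢b refl = no-common (proj₁ b-gap) (proj₂ b-gap) (proj₂ (∈-gaps {d} (‼⇒∈ (gaps d) j ea)))

  shape-Qof : ∀ R → shape (Qof n R) ≡ map overflow (reverse R)
  shape-Qof R = trans (sym (map-∘ (reverse R))) (map-cong-local (All.universal overflow-length (reverse R)))
    where
    overflow-length : ∀ c → length (map ((2 * n + 1) ∸_) (reverse (filter (n <?_) c))) ≡ overflow c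
    overflow-length c = trans (length-map _ (reverse (filter (n <?_) c))) (length-reverse (filter (n <?_) c))

  cut : List ℕ → ℕ → List ℕ
  cut col l = take (n ∸ l) col

  cut-overflow : ∀ {cs} → All IsColumn cs → zipWith cut cs (map overflow cs) ≡ map low cs
  cut-overflow []           = refl
  cut-overflow (col ∷ cols) = cong₂ _∷_ (take-low col) (cut-overflow cols)

module Tableau (n w : ℕ) (w>0 : 0 < w) (R : Tab) (rect : Rectangular w n R)
               (semistandard : Semistandard R) (content : HasContent w n R) where
  open Columns n

  entries-positive : All (All (1 ≤_)) R
  entries-positive = AllP.concat⁻ (All-resp-↭ (↭-sym content) (AllP.++⁺
    (AllP.concat⁺ (AllP.replicate⁺ (w ∸ 1) range-positive))
    (AllP.map⁺ (All.map (λ {x} 1≤x → ≤-trans 1≤x (m≤n+m x n)) range-positive))))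
    where
    range-positive : All (1 ≤_) range
    range-positive = All.tabulate (proj₁ ∘ ∈-range⁻)

  columns : All IsColumn R
  columns = All.zip (colsStrict⇒sorted (proj₂ (proj₂ semistandard)) , All.zip (proj₂ rect , entries-positive))

  -- Counting content: x ∈ [n] lies in w - 1 columns, hence is missing from one.
  missing-once : ∀ {x} → x ∈ range → length (filter (x ∉?_) R) ≡ 1
  missing-once {x} x∈ = begin
    missing                      ≡⟨ m+n∸m≡n present missing ⟨
    present + missing ∸ present  ≡⟨ cong₂ _∸_ (trans present+missing (proj₁ rect)) present≡ ⟩
    w ∸ (w ∸ 1)                  ≡⟨ m∸[m∸n]≡n w>0 ⟩
    1                            ∎
    where
    open ≡-Reasoning
    present missing : ℕ
    present = length (filter (x ∈?_) R)
    missing = length (filter (x ∉?_) R)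
    present+missing : present + missing ≡ length R
    present+missing = length-filter-split (x ∈?_) (x ∉?_) (λ x∈c x∉c → x∉c x∈c) id R
    present≡ : present ≡ w ∸ 1
    present≡ = begin
      present                              ≡⟨ multiplicity-concat x R (All.map (AllPairs.map <⇒≢ ∘ proj₁) columns) ⟨
      multiplicity x (concat R)            ≡⟨ ↭-length (filter-↭ (x ≟_) content) ⟩
      multiplicity x (concat (replicate (w ∸ 1) range) ++ map (n +_) range)
        ≡⟨ multiplicity-++ x (concat (replicate (w ∸ 1) range)) _ ⟩
      multiplicity x (concat (replicate (w ∸ 1) range)) + multiplicity x (map (n +_) range)
        ≡⟨ cong₂ _+_ (multiplicity-replicate range-unique x∈ (w ∸ 1)) (multiplicity-∉ not-high) ⟩
      w ∸ 1 + 0                            ≡⟨ +-identityʳ (w ∸ 1) ⟩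
      w ∸ 1                                ∎
      where
      not-high : x ∉ map (n +_) range
      not-high x∈high with y , y∈ , refl ← ∈-map⁻ (n +_) x∈high =
        <⇒≱ (<-≤-trans (m<m+n n (proj₁ (∈-range⁻ y∈))) (proj₂ (∈-range⁻ x∈))) ≤-refl

  LeftOf : List ℕ → List ℕ → Set
  LeftOf c d = IsColumn c × IsColumn d × RowWeak c d × NoCommonGap c d

  column-pairs : AllPairs LeftOf R
  column-pairs = AllPairs-All columns
    (AllPairs.zipWith (λ (rw , nc) → rw , nc) (rowsWeak⇒AllPairs (proj₁ (proj₂ semistandard)) , no-common-gap))
    where
    no-common-gap : AllPairs NoCommonGap R
    no-common-gap = Indexed⇒AllPairs λ lt ec ed {x} x∈ →
      AllPairs⇒Indexed (at-most-one (x ∉?_) R (≤-reflexive (missing-once x∈))) lt ec ed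

  P : Tab
  P = map gaps (reverse R)

  minus-is-low : minus w n R (shape (Qof n R)) ≡ map low R
  minus-is-low = begin
    minus w n R (shape (Qof n R))           ≡⟨ cong (minus w n R) (shape-Qof R) ⟩
    minus w n R (map overflow (reverse R))  ≡⟨ cong (zipWith cut R) overflows ⟩
    zipWith cut R (map overflow R)          ≡⟨ cut-overflow columns ⟩
    map low R                               ∎
    where
    open ≡-Reasoning
    overflows : reverse (pad w (map overflow (reverse R))) ≡ map overflow R
    overflows = begin
      reverse (pad w (map overflow (reverse R)))  ≡⟨ cong reverse (pad-full 0 w (map overflow (reverse R)) full) ⟩
      reverse (map overflow (reverse R))          ≡⟨ reverse-map overflow (reverse R) ⟨
      map overflow (reverse (reverse R))          ≡⟨ cong (map overflow) (reverse-involutive R) ⟩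
      map overflow R                              ∎
      where
      full : length (map overflow (reverse R)) ≡ w
      full = trans (length-map overflow (reverse R)) (trans (length-reverse R) (proj₁ rect))

  complement-of-low : complementT w n (map low R) ≡ P
  complement-of-low = begin
    map (range ∖_) (reverse (padT w (map low R)))  ≡⟨ cong (map (range ∖_) ∘ reverse)
                                                        (pad-full [] w (map low R) (trans (length-map low R) (proj₁ rect))) ⟩
    map (range ∖_) (reverse (map low R))           ≡⟨ cong (map (range ∖_)) (reverse-map low R) ⟨
    map (range ∖_) (map low (reverse R))           ≡⟨ map-∘ (reverse R) ⟨
    P                                              ∎
    where open ≡-Reasoning

  complement-is-P : complementT w n (minus w n R (shape (Qof n R))) ≡ P
  complement-is-P = trans (cong (complementT w n) minus-is-low) complement-of-low

  -- P has the shape of Q, since a column has as many gaps as overflowing entries.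
  shape-P : shape P ≡ map overflow (reverse R)
  shape-P = trans (sym (map-∘ (reverse R))) (map-cong-local (All.map gaps-length (All-reverse columns)))

  -- Column j of P comes from column w-1-j of R; pairs of columns of P are
  -- pairs of columns of R read in reverse.
  P-pairs : ∀ {S : List ℕ → List ℕ → Set} → (∀ {c d} → LeftOf c d → S (gaps d) (gaps c)) → AllPairs S P
  P-pairs compare = AllPairsP.map⁺ (AllPairs-reverse (AllPairs.map compare column-pairs))

  -- Overflows grow from left to right in R, so the columns of P shrink.
  P-young : IsYoung (shape P)
  P-young = subst IsYoung (sym shape-P)
    (AllPairs⇒Linked (AllPairsP.map⁺ (AllPairs-reverse
      (AllPairs.map (λ (cc , cd , rw , _) → overflow-mono cc cd rw) column-pairs))))

  P-rows-strict : RowsStrict P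
  P-rows-strict = AllPairs⇒rowsStrict (P-pairs (λ (cc , cd , rw , nc) → gaps-row-strict cc cd rw nc))

  P-cols-strict : ColsStrict P
  P-cols-strict = sorted⇒colsStrict (AllP.map⁺ (All.universal gaps-sorted (reverse R)))

  -- Every x ∈ [n] is a gap of exactly one column, so P contains [n] once.
  P-entries : concat P ↭ range
  P-entries = ↭-from-sets unique-P range-unique within covers
    where
    unique-P : Unique (concat P)
    unique-P = UniqueP.concat⁺ (AllP.map⁺ (All.universal (λ c → AllPairs.map <⇒≢ (gaps-sorted c)) (reverse R)))
                               (P-pairs (λ (_ , _ , _ , nc) → gaps-disjoint nc))
    within : concat P ⊆ range
    within x∈ with xs , x∈xs , xs∈P ← ∈-concat⁻′ P x∈ with c , _ , refl ← ∈-map⁻ gaps xs∈P =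
      proj₁ (∈-gaps {c} x∈xs)
    covers : range ⊆ concat P
    covers {x} x∈ with c , c∈R , x∉c ← some-witness (x ∉?_) R (≤-reflexive (sym (missing-once x∈))) =
      ∈-concat⁺′ (∈-filter⁺ (_∉? low c) x∈ λ x∈low → x∉c (proj₁ (∈-filter⁻ (_≤? n) {xs = c} x∈low)))
                 (∈-map⁺ gaps (AnyP.reverse⁺ c∈R))

  P-standard : Standard P
  P-standard = (P-young , (λ lt ea eb → <⇒≤ (P-rows-strict lt ea eb)) , P-cols-strict) , P-rows-strict ,
    subst (λ k → concat P ↭ oneTo k) (sym (trans (↭-length P-entries) range-length)) P-entries

lemma4p2 : (w n : ℕ) → 0 < w → 0 < n → (R : Tab) →
    Rectangular w n R → Semistandard R → HasContent w n R →
    Standard (complementT w n (minus w n R (shape (Qof n R))))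
    × (shape (complementT w n (minus w n R (shape (Qof n R)))) ≡ shape (Qof n R))
lemma4p2 w n w>0 _ R rect semistandard content =
  subst Standard (sym complement-is-P) P-standard ,
  trans (cong shape complement-is-P) (trans shape-P (sym (shape-Qof R)))
  where
  open Columns n using (shape-Qof)
  open Tableau n w w>0 R rect semistandard content
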